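{- Let $G$ be a complete graph with $n$ vertices, and let $b,n',a,m,\Delta$ be non-negative integers with $b-\Delta\ge a\ge 2$ and $n>\frac{(b+a-2+2m)(b+a)}{\Delta+a}+n'$. Then $G$ is fractional $(a,b,n',m)$-critical deleted.
   Context: For integers $0\le a\le b$, a fractional $[a,b]$-factor of a graph $G$ is a function $h:E(G)\to[0,1]$ such that $a\le\sum_{e\ni x}h(e)\le b$ for every vertex $x$. $G$ is fractional $(a,b,m)$-deleted if for every $H\subseteq E(G)$ with $|H|=m$, $G-H$ has a fractional $[a,b]$-factor. $G$ is fractional $(a,b,n',m)$-critical deleted if for every $U\subseteq V(G)$ with $|U|=n'$, $G-U$ is fractional $(a,b,m)$-deleted. -}

module Defs where

open import Data.Nat using (ℕ; zero; suc; _<_)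
open import Data.Bool using (Bool; true; false; _∧_; not; T; if_then_else_)
open import Data.Fin using (Fin; toℕ; _≟_)
open import Data.Fin.Subset using (Subset; _∈_; _∉_; ∣_∣)
open import Data.Vec using (lookup)
open import Data.Product using (_×_; _,_; Σ)
open import Data.List using (List; length)
open import Data.Bool.ListAction using (any)
open import Data.List.Relation.Unary.All using (All)
open import Data.List.Relation.Unary.Unique.Propositional using (Unique)
open import Data.Integer using (+_)
open import Data.Rational using (ℚ; _+_; _≤_; 0ℚ; 1ℚ; _/_)
open import Relation.Nullary.Decidable using (⌊_⌋)
open import Relation.Binary.PropositionalEquality using (_≡_)

-- A (simple) graph on a vertex set V ⊆ Fin n, given by a vertex subset
-- and an adjacency function; only pairs of distinct present vertices
-- with adj true are edges (adjacency is read symmetrically via edges x<y).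
record Graph (n : ℕ) : Set where
  field
    alive : Subset n
    adj   : Fin n → Fin n → Bool
open Graph public

isAlive : ∀ {n} → Graph n → Fin n → Bool
isAlive G x = lookup (alive G) x

Edge : ∀ {n} → Graph n → Fin n → Fin n → Set
Edge G x y = T (isAlive G x) × T (isAlive G y) × T (adj G x y) × T (adj G y x)

complete : (n : ℕ) → Graph n
complete n = record { alive = Data.Fin.Subset.⊤ ; adj = λ x y → not ⌊ x ≟ y ⌋ }

deleteV : ∀ {n} → Graph n → Subset n → Graph n
deleteV G U = record { alive = Data.Vec.zipWith (λ a u → a ∧ not u) (alive G) U ; adj = adj G }

-- an edge set H, listed as ordered pairs (x , y) with toℕ x < toℕ y
-- (each unordered edge written exactly once)
EdgeSet : ∀ {n} → Graph n → ℕ → List (Fin n × Fin n) → Set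
EdgeSet G m H =
  All (λ { (x , y) → Edge G x y × toℕ x < toℕ y }) H × Unique H × length H ≡ m

memPair : ∀ {n} → List (Fin n × Fin n) → Fin n → Fin n → Bool
memPair H x y = any (λ { (u , v) → ⌊ u ≟ x ⌋ ∧ ⌊ v ≟ y ⌋ }) H

deleteE : ∀ {n} → Graph n → List (Fin n × Fin n) → Graph n
deleteE G H = record
  { alive = alive G
  ; adj = λ x y → adj G x y ∧ not (memPair H x y) ∧ not (memPair H y x) }

edgeB : ∀ {n} → Graph n → Fin n → Fin n → Bool
edgeB G x y = isAlive G x ∧ isAlive G y ∧ adj G x y ∧ adj G y x

sumFin : ∀ {n} → (Fin n → ℚ) → ℚ
sumFin {zero}  f = 0ℚ
sumFin {suc n} f = f Data.Fin.zero + sumFin (λ i → f (Data.Fin.suc i))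

ℕtoℚ : ℕ → ℚ
ℕtoℚ k = (+ k) / 1

-- h(x,y) is the value on the edge {x,y}; symmetry makes it a function on edges
-- (values on non-edges are irrelevant).
degreeSum : ∀ {n} → Graph n → (Fin n → Fin n → ℚ) → Fin n → ℚ
degreeSum G h x = sumFin (λ y → if edgeB G x y then h x y else 0ℚ)

FractionalFactor : ∀ {n} → ℕ → ℕ → Graph n → Set
FractionalFactor {n} a b G =
  Σ (Fin n → Fin n → ℚ) λ h →
    (∀ x y → Edge G x y → h x y ≡ h y x) ×
    (∀ x y → Edge G x y → (0ℚ ≤ h x y) × (h x y ≤ 1ℚ)) ×
    (∀ x → T (isAlive G x) → (ℕtoℚ a ≤ degreeSum G h x) × (degreeSum G h x ≤ ℕtoℚ b))

FractionalDeleted : ∀ {n} → ℕ → ℕ → ℕ → Graph n → Set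
FractionalDeleted a b m G =
  ∀ H → EdgeSet G m H → FractionalFactor a b (deleteE G H)

FractionalCriticalDeleted : ∀ {n} → ℕ → ℕ → ℕ → ℕ → Graph n → Set
FractionalCriticalDeleted {n} a b n' m G =
  ∀ (U : Subset n) → ∣ U ∣ ≡ n' → FractionalDeleted a b m (deleteV G U)

-- After deleting U and H, the alive vertices span a complete graph on N = n - n' vertices from
-- which at most m edges are missing. Call a vertex full if it misses no edge, let K be the number
-- of full vertices and D the total number of missing edge-ends, so that N ≤ K + D and D ≤ 2m.
-- Weight an edge pq by K(K-1) - D if p and q are both full, by K(K-1) + (K-1)d if exactly one of
-- them is full and the other misses d edges, and by K(K-1) otherwise. A non-full vertex missing d
-- edges loses d K(K-1) and regains (K-1)d on each of its K edges to full vertices; a full vertex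
-- loses D on each edge to the other K-1 full vertices and regains (K-1)D on the remaining ones. So
-- every vertex has weighted degree (N-1)K(K-1), and scaling by a/((N-1)K(K-1)) gives a fractional
-- a-factor. The bound on n yields D ≤ K(K-1), so no weight is negative, and
-- a(K(K-1) + (K-1)D) ≤ (N-1)K(K-1), so no scaled weight exceeds 1.

module Submission where

open import Defs
open import Data.Nat using (ℕ; zero; suc; pred; _+_; _*_; _∸_; _≤_; _<_; z≤n; s≤s; NonZero; >-nonZero; _≡ᵇ_)
open import Data.Nat.Properties hiding (_≟_; suc-injective)
open import Data.Nat.Tactic.RingSolver using (solve-∀)
open import Data.Bool using (Bool; true; false; _∧_; _∨_; not; T; if_then_else_)
open import Data.Bool.Properties using (∧-comm; ∧-identityʳ; T-≡)
open import Data.Fin using (Fin; _≟_)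
open import Data.Fin.Properties using (suc-injective)
open import Data.Fin.Subset using (Subset; ∣_∣)
open import Data.Vec using ([]; _∷_)
open import Data.List using (List; []; _∷_; length)
open import Data.Product using (_×_; _,_)
open import Data.Integer as ℤ using (+_)
import Data.Integer.Properties as ℤ
open import Data.Rational as ℚ using (ℚ; 0ℚ; 1ℚ; toℚᵘ; _/_)
open import Data.Rational.Properties using (0/n≡0; toℚᵘ-fromℚᵘ; toℚᵘ-homo-+; toℚᵘ-injective; toℚᵘ-cancel-≤)
open import Data.Rational.Unnormalised as ℚᵘ using (mkℚᵘ; *≡*; *≤*)
import Data.Rational.Unnormalised.Properties as ℚᵘ
open import Function using (_∘_; Equivalence)
open import Relation.Nullary.Decidable using (⌊_⌋; yes; no; dec-true; dec-false; isYes≗does; ⌊⌋-map′)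
open import Relation.Nullary.Negation using (contradiction)
open import Relation.Binary.PropositionalEquality hiding ([_])
open import Algebra.Properties.Semiring.Sum +-*-semiring
  using (sum; sum-cong-≗; sum-replicate-zero; ∑-distrib-+; ∑-comm; *-distribˡ-sum)

-- Indicators and finite sums

[_] : Bool → ℕ
[ true ]  = 1
[ false ] = 0

[∧] : ∀ x y → [ x ∧ y ] ≡ [ x ] * [ y ]
[∧] true  y = sym (+-identityʳ [ y ])
[∧] false y = refl

[∨]≤ : ∀ x y → [ x ∨ y ] ≤ [ x ] + [ y ]
[∨]≤ true  y = s≤s z≤n
[∨]≤ false y = ≤-refl

≟-sym : ∀ {n} (p q : Fin n) → ⌊ p ≟ q ⌋ ≡ ⌊ q ≟ p ⌋
≟-sym p q with p ≟ q | q ≟ p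
... | yes _   | yes _   = refl
... | no _    | no _    = refl
... | yes p≡q | no q≢p  = contradiction (sym p≡q) q≢p
... | no p≢q  | yes q≡p = contradiction (sym q≡p) p≢q

≟-refl : ∀ {n} (p : Fin n) → ⌊ p ≟ p ⌋ ≡ true
≟-refl p = trans (isYes≗does (p ≟ p)) (dec-true (p ≟ p) refl)

≟-≢ : ∀ {n} {p q : Fin n} → p ≢ q → ⌊ p ≟ q ⌋ ≡ false
≟-≢ {p = p} {q} p≢q = trans (isYes≗does (p ≟ q)) (dec-false (p ≟ q) p≢q)

sum-mono-≤ : ∀ {n} {f g : Fin n → ℕ} → (∀ i → f i ≤ g i) → sum f ≤ sum g
sum-mono-≤ {zero}  f≤g = z≤n
sum-mono-≤ {suc n} f≤g = +-mono-≤ (f≤g Fin.zero) (sum-mono-≤ (f≤g ∘ Fin.suc))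

term≤sum : ∀ {n} (f : Fin n → ℕ) i → f i ≤ sum f
term≤sum f Fin.zero    = m≤m+n _ _
term≤sum f (Fin.suc i) = ≤-trans (term≤sum (f ∘ Fin.suc) i) (m≤n+m _ (f Fin.zero))

sum-δ : ∀ {n} (p : Fin n) (f : Fin n → ℕ) → sum (λ q → f q * [ ⌊ p ≟ q ⌋ ]) ≡ f p
sum-δ {suc n} Fin.zero    f = trans
  (cong₂ _+_ (*-identityʳ (f Fin.zero)) (trans (sum-cong-≗ (λ q → *-zeroʳ (f (Fin.suc q)))) (sum-replicate-zero n)))
  (+-identityʳ (f Fin.zero))
sum-δ {suc n} (Fin.suc p) f =
  trans (cong₂ _+_ (*-zeroʳ (f Fin.zero))
                   (sum-cong-≗ (λ q → cong (λ b → f (Fin.suc q) * [ b ]) (⌊⌋-map′ (cong Fin.suc) suc-injective (p ≟ q)))))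
        (sum-δ p (f ∘ Fin.suc))

count-δ : ∀ {n} (p : Fin n) → sum (λ q → [ ⌊ p ≟ q ⌋ ]) ≡ 1
count-δ p = trans (sum-cong-≗ (λ q → sym (*-identityˡ [ ⌊ p ≟ q ⌋ ]))) (sum-δ p (λ _ → 1))

∑-*-distrib-+ : ∀ {n} (f g h : Fin n → ℕ) →
  sum (λ i → (f i + g i) * h i) ≡ sum (λ i → f i * h i) + sum (λ i → g i * h i)
∑-*-distrib-+ f g h = trans (sum-cong-≗ (λ i → *-distribʳ-+ (h i) (f i) (g i))) (∑-distrib-+ (λ i → f i * h i) (λ i → g i * h i))

∑-*-assoc : ∀ {n} c (f h : Fin n → ℕ) → sum (λ i → c * f i * h i) ≡ c * sum (λ i → f i * h i)
∑-*-assoc c f h = trans (sum-cong-≗ (λ i → *-assoc c (f i) (h i))) (sym (*-distribˡ-sum c (λ i → f i * h i)))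

∑∑-distrib-+ : ∀ {n} (f g : Fin n → Fin n → ℕ) →
  sum (λ p → sum (λ q → f p q + g p q)) ≡ sum (λ p → sum (f p)) + sum (λ p → sum (g p))
∑∑-distrib-+ f g = trans (sum-cong-≗ (λ p → ∑-distrib-+ (f p) (g p))) (∑-distrib-+ (λ p → sum (f p)) (λ p → sum (g p)))

-- Fractions with a common denominator

toℚᵘ-/ : ∀ x k .{{_ : NonZero k}} → toℚᵘ (+ x / k) ℚᵘ.≃ + x ℚᵘ./ k
toℚᵘ-/ x (suc d) = toℚᵘ-fromℚᵘ (mkℚᵘ (+ x) d)

/ᵘ-+ : ∀ x y k .{{_ : NonZero k}} → + x ℚᵘ./ k ℚᵘ.+ + y ℚᵘ./ k ℚᵘ.≃ + (x + y) ℚᵘ./ k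
/ᵘ-+ x y k@(suc _) = *≡* (begin
  (+ x ℤ.* + k ℤ.+ + y ℤ.* + k) ℤ.* + k ≡⟨ cong (ℤ._* + k) (ℤ.*-distribʳ-+ (+ k) (+ x) (+ y)) ⟨
  (+ x ℤ.+ + y) ℤ.* + k ℤ.* + k         ≡⟨ ℤ.*-assoc (+ x ℤ.+ + y) (+ k) (+ k) ⟩
  (+ x ℤ.+ + y) ℤ.* (+ k ℤ.* + k)       ≡⟨ cong₂ ℤ._*_ (ℤ.pos-+ x y) (ℤ.pos-* k k) ⟨
  + (x + y) ℤ.* + (k * k)               ∎)
  where open ≡-Reasoning

/-+ : ∀ x y k .{{_ : NonZero k}} → + x / k ℚ.+ + y / k ≡ + (x + y) / k
/-+ x y k = toℚᵘ-injective (begin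
  toℚᵘ (+ x / k ℚ.+ + y / k)          ≈⟨ toℚᵘ-homo-+ (+ x / k) (+ y / k) ⟩
  toℚᵘ (+ x / k) ℚᵘ.+ toℚᵘ (+ y / k)  ≈⟨ ℚᵘ.+-cong (toℚᵘ-/ x k) (toℚᵘ-/ y k) ⟩
  + x ℚᵘ./ k ℚᵘ.+ + y ℚᵘ./ k          ≈⟨ /ᵘ-+ x y k ⟩
  + (x + y) ℚᵘ./ k                    ≈⟨ toℚᵘ-/ (x + y) k ⟨
  toℚᵘ (+ (x + y) / k)                ∎)
  where open ℚᵘ.≃-Reasoning

/-mono-≤ : ∀ x y k l .{{_ : NonZero k}} .{{_ : NonZero l}} → x * l ≤ y * k → + x / k ℚ.≤ + y / l
/-mono-≤ x y k@(suc _) l@(suc _) xl≤yk = toℚᵘ-cancel-≤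
  (ℚᵘ.≤-respˡ-≃ (ℚᵘ.≃-sym (toℚᵘ-/ x k)) (ℚᵘ.≤-respʳ-≃ (ℚᵘ.≃-sym (toℚᵘ-/ y l))
    (*≤* (subst₂ ℤ._≤_ (ℤ.pos-* x l) (ℤ.pos-* y k) (ℤ.+≤+ xl≤yk)))))

sumFin-if-/ : ∀ {n} (c : Fin n → Bool) (f : Fin n → ℕ) k .{{_ : NonZero k}} →
  sumFin (λ i → if c i then + f i / k else 0ℚ) ≡ + sum (λ i → f i * [ c i ]) / k
sumFin-if-/ {zero}  c f k = sym (0/n≡0 k)
sumFin-if-/ {suc n} c f k =
  trans (cong₂ ℚ._+_ (if-/ (c Fin.zero)) (sumFin-if-/ (c ∘ Fin.suc) (f ∘ Fin.suc) k))
        (/-+ (f Fin.zero * [ c Fin.zero ]) (sum (λ i → f (Fin.suc i) * [ c (Fin.suc i) ])) k)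
  where
  if-/ : ∀ b → (if b then + f Fin.zero / k else 0ℚ) ≡ + (f Fin.zero * [ b ]) / k
  if-/ true  = cong (λ z → + z / k) (sym (*-identityʳ (f Fin.zero)))
  if-/ false = trans (sym (0/n≡0 k)) (cong (λ z → + z / k) (sym (*-zeroʳ (f Fin.zero))))

-- Complete graphs with missing edges

scaled-weight≤ : ∀ {a K k D M} → a ≤ K → a + D ≤ M → a * (K * k + k * D) ≤ K * k * M
scaled-weight≤ {a} {K} {k} {D} {M} a≤K a+D≤M = begin
  a * (K * k + k * D)        ≡⟨ expand a K k D ⟩
  a * (K * k) + k * (a * D)  ≤⟨ +-monoʳ-≤ (a * (K * k)) (*-monoʳ-≤ k (*-monoˡ-≤ D a≤K)) ⟩
  a * (K * k) + k * (K * D)  ≡⟨ collect a K k D ⟩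
  K * k * (a + D)            ≤⟨ *-monoʳ-≤ (K * k) a+D≤M ⟩
  K * k * M                  ∎
  where
  open ≤-Reasoning
  expand : ∀ a K k D → a * (K * k + k * D) ≡ a * (K * k) + k * (a * D)
  expand = solve-∀
  collect : ∀ a K k D → a * (K * k) + k * (K * D) ≡ K * k * (a + D)
  collect = solve-∀

module NearlyComplete {n : ℕ} (G : Graph n) (adj-irrefl : ∀ p → adj G p p ≡ false) where

  other : Fin n → Fin n → Bool
  other p q = isAlive G q ∧ not ⌊ p ≟ q ⌋

  linked : Fin n → Fin n → Bool
  linked p q = adj G p q ∧ adj G q p

  missing : Fin n → Fin n → Bool
  missing p q = isAlive G p ∧ other p q ∧ not (linked p q)

  deficiency : Fin n → ℕ
  deficiency p = sum (λ q → [ missing p q ])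

  full : Fin n → Bool
  full p = isAlive G p ∧ (deficiency p ≡ᵇ 0)

  N K D : ℕ
  N = sum (λ p → [ isAlive G p ])
  K = sum (λ p → [ full p ])
  D = sum deficiency

  pairs : ℕ
  pairs = K * pred K

  pairWeight : Bool → Bool → ℕ → ℕ → ℕ
  pairWeight true  true  _ _ = pairs ∸ D
  pairWeight true  false _ y = pairs + pred K * y
  pairWeight false true  x _ = pairs + pred K * x
  pairWeight false false _ _ = pairs

  weight : Fin n → Fin n → ℕ
  weight p q = pairWeight (full p) (full q) (deficiency p) (deficiency q)

  weight-sym : ∀ p q → weight p q ≡ weight q p
  weight-sym p q = pairWeight-sym (full p) (full q)
    where
    pairWeight-sym : ∀ u v {x y} → pairWeight u v x y ≡ pairWeight v u y x
    pairWeight-sym true  true  = refl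
    pairWeight-sym true  false = refl
    pairWeight-sym false true  = refl
    pairWeight-sym false false = refl

  deficiency≤D : ∀ p → deficiency p ≤ D
  deficiency≤D = term≤sum deficiency

  weight≤ : ∀ p q → weight p q ≤ pairs + pred K * D
  weight≤ p q = pairWeight≤ (full p) (full q) (deficiency≤D p) (deficiency≤D q)
    where
    pairWeight≤ : ∀ u v {x y} → x ≤ D → y ≤ D → pairWeight u v x y ≤ pairs + pred K * D
    pairWeight≤ true  true  _   _   = ≤-trans (m∸n≤m pairs D) (m≤m+n pairs _)
    pairWeight≤ true  false _   y≤D = +-monoʳ-≤ pairs (*-monoʳ-≤ (pred K) y≤D)
    pairWeight≤ false true  x≤D _   = +-monoʳ-≤ pairs (*-monoʳ-≤ (pred K) x≤D)
    pairWeight≤ false false _   _   = m≤m+n pairs _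

  N≤K+D : N ≤ K + D
  N≤K+D = ≤-trans (sum-mono-≤ (λ p → alive≤full+deficiency (isAlive G p) (deficiency p)))
                  (≤-reflexive (∑-distrib-+ (λ p → [ full p ]) deficiency))
    where
    alive≤full+deficiency : ∀ a d → [ a ] ≤ [ a ∧ (d ≡ᵇ 0) ] + d
    alive≤full+deficiency false _       = z≤n
    alive≤full+deficiency true  zero    = ≤-refl
    alive≤full+deficiency true  (suc _) = s≤s z≤n

  full⇒alive : ∀ {q} → full q ≡ true → isAlive G q ≡ true
  full⇒alive {q} with isAlive G q
  ... | true  = λ _ → refl
  ... | false = λ ()

  full⇒deficiency≡0 : ∀ {q} → full q ≡ true → deficiency q ≡ 0
  full⇒deficiency≡0 {q} with isAlive G q | deficiency q
  ... | true  | zero  = λ _ → refl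
  ... | true  | suc _ = λ ()
  ... | false | _     = λ ()

  full⇒¬missing : ∀ {q} → full q ≡ true → ∀ r → missing q r ≡ false
  full⇒¬missing {q} fq r = [b]≤0 (subst ([ missing q r ] ≤_) (full⇒deficiency≡0 fq) (term≤sum (λ r → [ missing q r ]) r))
    where
    [b]≤0 : ∀ {b} → [ b ] ≤ 0 → b ≡ false
    [b]≤0 {false} _ = refl

  dead⇒deficiency≡0 : ∀ {q} → isAlive G q ≡ false → deficiency q ≡ 0
  dead⇒deficiency≡0 {q} dq =
    trans (sum-cong-≗ (λ r → cong (λ a → [ a ∧ other q r ∧ not (linked q r) ]) dq)) (sum-replicate-zero n)

  dead⇒¬full : ∀ {q} → isAlive G q ≡ false → full q ≡ false
  dead⇒¬full {q} dq = cong (_∧ (deficiency q ≡ᵇ 0)) dq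

  missing-sym : ∀ p q → missing p q ≡ missing q p
  missing-sym p q = trans (swap (isAlive G p) (isAlive G q))
    (cong₂ (λ e l → isAlive G q ∧ (isAlive G p ∧ not e) ∧ not l) (≟-sym p q) (∧-comm (adj G p q) (adj G q p)))
    where
    swap : ∀ a b {e l} → a ∧ (b ∧ not e) ∧ not l ≡ b ∧ (a ∧ not e) ∧ not l
    swap false false = refl
    swap false true  = refl
    swap true  false = refl
    swap true  true  = refl

  linked-irrefl : ∀ p q → ⌊ p ≟ q ⌋ ≡ true → linked p q ≡ false
  linked-irrefl p q with p ≟ q
  ... | yes refl = λ _ → cong (_∧ adj G p p) (adj-irrefl p)
  ... | no _     = λ ()

  edge+missing : ∀ {p} → isAlive G p ≡ true → ∀ q → [ edgeB G p q ] + [ missing p q ] ≡ [ other p q ]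
  edge+missing {p} ap q = split (isAlive G q) ⌊ p ≟ q ⌋ (linked p q) ap (linked-irrefl p q)
    where
    split : ∀ {a} b e l → a ≡ true → (e ≡ true → l ≡ false) →
      [ a ∧ b ∧ l ] + [ a ∧ (b ∧ not e) ∧ not l ] ≡ [ b ∧ not e ]
    split false _     _     refl _ = refl
    split true  false false refl _ = refl
    split true  false true  refl _ = refl
    split true  true  false refl _ = refl
    split true  true  true  refl irr with () ← irr refl

  ¬full⇒edge-to-full : ∀ {p q} → isAlive G p ≡ true → full p ≡ false → full q ≡ true → edgeB G p q ≡ true
  ¬full⇒edge-to-full {p} {q} ap fp fq =
    present ap (full⇒alive fq) (≟-≢ p≢q) (trans (missing-sym p q) (full⇒¬missing fq p))
    where
    p≢q : p ≢ q
    p≢q p≡q = contradiction (trans (sym fp) (trans (cong full p≡q) fq)) λ ()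
    present : ∀ {a b e l} → a ≡ true → b ≡ true → e ≡ false → a ∧ (b ∧ not e) ∧ not l ≡ false → a ∧ b ∧ l ≡ true
    present {l = true}  refl refl refl _ = refl
    present {l = false} refl refl refl ()

  sum-alive : ∀ f → (∀ q → isAlive G q ≡ false → f q ≡ 0) → sum (λ q → f q * [ isAlive G q ]) ≡ sum f
  sum-alive f vanish = sum-cong-≗ pointwise
    where
    pointwise : ∀ q → f q * [ isAlive G q ] ≡ f q
    pointwise q with isAlive G q in aq
    ... | true  = *-identityʳ (f q)
    ... | false = trans (*-zeroʳ (f q)) (sym (vanish q aq))

  sum-others : ∀ {p} → isAlive G p ≡ true → ∀ f →
    f p + sum (λ q → f q * [ other p q ]) ≡ sum (λ q → f q * [ isAlive G q ])
  sum-others {p} ap f = begin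
    f p + sum (λ q → f q * [ other p q ])
      ≡⟨ cong (_+ sum (λ q → f q * [ other p q ])) (sum-δ p f) ⟨
    sum (λ q → f q * [ ⌊ p ≟ q ⌋ ]) + sum (λ q → f q * [ other p q ])
      ≡⟨ ∑-distrib-+ (λ q → f q * [ ⌊ p ≟ q ⌋ ]) (λ q → f q * [ other p q ]) ⟨
    sum (λ q → f q * [ ⌊ p ≟ q ⌋ ] + f q * [ other p q ])
      ≡⟨ sum-cong-≗ (λ q → trans (sym (*-distribˡ-+ (f q) _ _)) (cong (f q *_) (self+other q))) ⟩
    sum (λ q → f q * [ isAlive G q ]) ∎
    where
    open ≡-Reasoning
    self+other : ∀ q → [ ⌊ p ≟ q ⌋ ] + [ isAlive G q ∧ not ⌊ p ≟ q ⌋ ] ≡ [ isAlive G q ]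
    self+other q with p ≟ q
    ... | yes refl rewrite ap = refl
    ... | no _ = cong [_] (∧-identityʳ (isAlive G q))

  count-others : ∀ {p} → isAlive G p ≡ true → sum (λ q → [ other p q ]) ≡ pred N
  count-others {p} ap = begin
    sum (λ q → [ other p q ])           ≡⟨ sum-cong-≗ (λ q → *-identityˡ [ other p q ]) ⟨
    sum (λ q → 1 * [ other p q ])       ≡⟨ cong pred (sum-others ap (λ _ → 1)) ⟩
    pred (sum (λ q → 1 * [ isAlive G q ])) ≡⟨ cong pred (sum-cong-≗ (λ q → *-identityˡ [ isAlive G q ])) ⟩
    pred N                              ∎
    where open ≡-Reasoning

  count-full-others : ∀ {p} → full p ≡ true → sum (λ q → [ full q ] * [ other p q ]) ≡ pred K
  count-full-others {p} fp = cong pred (begin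
    1 + sum (λ q → [ full q ] * [ other p q ])      ≡⟨ cong (λ b → [ b ] + sum (λ q → [ full q ] * [ other p q ])) fp ⟨
    [ full p ] + sum (λ q → [ full q ] * [ other p q ]) ≡⟨ sum-others (full⇒alive fp) (λ q → [ full q ]) ⟩
    sum (λ q → [ full q ] * [ isAlive G q ])       ≡⟨ sum-alive (λ q → [ full q ]) (λ q → cong [_] ∘ dead⇒¬full) ⟩
    K                                               ∎)
    where open ≡-Reasoning

  sum-others-deficiency : ∀ {p} → full p ≡ true → sum (λ q → deficiency q * [ other p q ]) ≡ D
  sum-others-deficiency {p} fp = begin
    sum (λ q → deficiency q * [ other p q ])   ≡⟨ cong (_+ sum (λ q → deficiency q * [ other p q ])) (full⇒deficiency≡0 fp) ⟨
    deficiency p + sum (λ q → deficiency q * [ other p q ]) ≡⟨ sum-others (full⇒alive fp) deficiency ⟩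
    sum (λ q → deficiency q * [ isAlive G q ]) ≡⟨ sum-alive deficiency (λ q → dead⇒deficiency≡0) ⟩
    D                                          ∎
    where open ≡-Reasoning

  edges+deficiency : ∀ {p} → isAlive G p ≡ true → sum (λ q → [ edgeB G p q ]) + deficiency p ≡ pred N
  edges+deficiency {p} ap = begin
    sum (λ q → [ edgeB G p q ]) + deficiency p          ≡⟨ ∑-distrib-+ (λ q → [ edgeB G p q ]) (λ q → [ missing p q ]) ⟨
    sum (λ q → [ edgeB G p q ] + [ missing p q ])       ≡⟨ sum-cong-≗ (edge+missing ap) ⟩
    sum (λ q → [ other p q ])                           ≡⟨ count-others ap ⟩
    pred N                                              ∎
    where open ≡-Reasoning

  weight-at-¬full : ∀ {p} → full p ≡ false → ∀ q → weight p q ≡ pairs + pred K * deficiency p * [ full q ]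
  weight-at-¬full {p} fp q =
    trans (cong (λ u → pairWeight u (full q) (deficiency p) (deficiency q)) fp) (row (full q))
    where
    row : ∀ v → pairWeight false v (deficiency p) (deficiency q) ≡ pairs + pred K * deficiency p * [ v ]
    row true  = cong (_+_ pairs) (sym (*-identityʳ (pred K * deficiency p)))
    row false = trans (sym (+-identityʳ pairs)) (cong (_+_ pairs) (sym (*-zeroʳ (pred K * deficiency p))))

  weight-at-full : ∀ {p} → full p ≡ true → D ≤ pairs → ∀ q →
    weight p q + D * [ full q ] ≡ pairs + pred K * deficiency q
  weight-at-full {p} fp D≤pairs q =
    trans (cong₂ (λ u x → pairWeight u (full q) x (deficiency q) + D * [ full q ]) fp (full⇒deficiency≡0 fp))
          (row (full q) full⇒deficiency≡0)
    where
    open ≡-Reasoning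
    row : ∀ v → (v ≡ true → deficiency q ≡ 0) → pairWeight true v 0 (deficiency q) + D * [ v ] ≡ pairs + pred K * deficiency q
    row true full⇒0 = begin
      pairs ∸ D + D * 1            ≡⟨ cong (_+_ (pairs ∸ D)) (*-identityʳ D) ⟩
      pairs ∸ D + D                ≡⟨ m∸n+n≡m D≤pairs ⟩
      pairs                        ≡⟨ +-identityʳ pairs ⟨
      pairs + 0                    ≡⟨ cong (_+_ pairs) (trans (cong (pred K *_) (full⇒0 refl)) (*-zeroʳ (pred K))) ⟨
      pairs + pred K * deficiency q ∎
    row false _ = trans (cong (_+_ _) (*-zeroʳ D)) (+-identityʳ _)

  weighted-degree-¬full : ∀ {p} → isAlive G p ≡ true → full p ≡ false →
    sum (λ q → weight p q * [ edgeB G p q ]) ≡ pairs * pred N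
  weighted-degree-¬full {p} ap fp = begin
    sum (λ q → weight p q * [ e q ])
      ≡⟨ sum-cong-≗ (λ q → cong (_* [ e q ]) (weight-at-¬full fp q)) ⟩
    sum (λ q → (pairs + c * [ full q ]) * [ e q ])
      ≡⟨ ∑-*-distrib-+ (λ _ → pairs) (λ q → c * [ full q ]) (λ q → [ e q ]) ⟩
    sum (λ q → pairs * [ e q ]) + sum (λ q → c * [ full q ] * [ e q ])
      ≡⟨ cong₂ _+_ (sym (*-distribˡ-sum pairs (λ q → [ e q ]))) (sum-cong-≗ full-edge) ⟩
    pairs * sum (λ q → [ e q ]) + sum (λ q → c * [ full q ])
      ≡⟨ cong (_+_ (pairs * sum (λ q → [ e q ]))) (trans (sym (*-distribˡ-sum c (λ q → [ full q ]))) c*K≡pairs*d) ⟩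
    pairs * sum (λ q → [ e q ]) + pairs * deficiency p
      ≡⟨ *-distribˡ-+ pairs _ _ ⟨
    pairs * (sum (λ q → [ e q ]) + deficiency p)
      ≡⟨ cong (pairs *_) (edges+deficiency ap) ⟩
    pairs * pred N ∎
    where
    open ≡-Reasoning
    e = edgeB G p
    c = pred K * deficiency p
    full-edge : ∀ q → c * [ full q ] * [ e q ] ≡ c * [ full q ]
    full-edge q with full q in fq
    ... | true rewrite ¬full⇒edge-to-full ap fp fq = *-identityʳ (c * 1)
    ... | false = trans (cong (_* [ e q ]) (*-zeroʳ c)) (sym (*-zeroʳ c))
    c*K≡pairs*d : c * K ≡ pairs * deficiency p
    c*K≡pairs*d = trans (*-comm c K) (sym (*-assoc K (pred K) (deficiency p)))

  weighted-degree-full : ∀ {p} → full p ≡ true → D ≤ pairs → sum (λ q → weight p q * [ edgeB G p q ]) ≡ pairs * pred N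
  weighted-degree-full {p} fp D≤pairs = +-cancelʳ-≡ (D * pred K) _ _ (begin
    sum (λ q → weight p q * [ edgeB G p q ]) + D * pred K
      ≡⟨ cong₂ _+_ (sum-cong-≗ (λ q → cong (weight p q *_) (edge≡other {q}))) (cong (D *_) (sym (count-full-others fp))) ⟩
    sum (λ q → weight p q * [ o q ]) + D * sum (λ q → [ full q ] * [ o q ])
      ≡⟨ cong (_+_ _) (∑-*-assoc D (λ q → [ full q ]) (λ q → [ o q ])) ⟨
    sum (λ q → weight p q * [ o q ]) + sum (λ q → D * [ full q ] * [ o q ])
      ≡⟨ ∑-*-distrib-+ (weight p) (λ q → D * [ full q ]) (λ q → [ o q ]) ⟨
    sum (λ q → (weight p q + D * [ full q ]) * [ o q ])
      ≡⟨ sum-cong-≗ (λ q → cong (_* [ o q ]) (weight-at-full fp D≤pairs q)) ⟩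
    sum (λ q → (pairs + pred K * deficiency q) * [ o q ])
      ≡⟨ ∑-*-distrib-+ (λ _ → pairs) (λ q → pred K * deficiency q) (λ q → [ o q ]) ⟩
    sum (λ q → pairs * [ o q ]) + sum (λ q → pred K * deficiency q * [ o q ])
      ≡⟨ cong₂ _+_ (sym (*-distribˡ-sum pairs (λ q → [ o q ]))) (∑-*-assoc (pred K) deficiency (λ q → [ o q ])) ⟩
    pairs * sum (λ q → [ o q ]) + pred K * sum (λ q → deficiency q * [ o q ])
      ≡⟨ cong₂ (λ x y → pairs * x + pred K * y) (count-others (full⇒alive fp)) (sum-others-deficiency fp) ⟩
    pairs * pred N + pred K * D
      ≡⟨ cong (_+_ _) (*-comm (pred K) D) ⟩
    pairs * pred N + D * pred K ∎)
    where
    open ≡-Reasoning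
    o = other p
    edge≡other : ∀ {q} → [ edgeB G p q ] ≡ [ o q ]
    edge≡other {q} = trans (sym (+-identityʳ _))
      (trans (cong (λ b → [ edgeB G p q ] + [ b ]) (sym (full⇒¬missing fp q))) (edge+missing (full⇒alive fp) q))

  weighted-degree : ∀ {p} → isAlive G p ≡ true → D ≤ pairs → sum (λ q → weight p q * [ edgeB G p q ]) ≡ pairs * pred N
  weighted-degree {p} ap D≤pairs = by-fullness (full p) refl
    where
    by-fullness : ∀ b → full p ≡ b → sum (λ q → weight p q * [ edgeB G p q ]) ≡ pairs * pred N
    by-fullness true  fp = weighted-degree-full fp D≤pairs
    by-fullness false fp = weighted-degree-¬full ap fp

  fractionalFactor : ∀ {a b} → 2 ≤ a → a ≤ b → a ≤ K → D ≤ pairs → a + D ≤ pred N → FractionalFactor a b G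
  fractionalFactor {a} {b} 2≤a a≤b a≤K D≤pairs a+D≤N-1 = h , (λ p q _ → h-sym p q) , (λ p q _ → h-bounds p q) , h-degree
    where
    den : ℕ
    den = pairs * pred N

    0<den : 0 < den
    0<den = *-mono-< (*-mono-< (≤-trans (s≤s z≤n) 2≤K) (pred-mono-≤ 2≤K))
                     (≤-trans (≤-trans (s≤s z≤n) 2≤a) (m+n≤o⇒m≤o a a+D≤N-1))
      where
      2≤K : 2 ≤ K
      2≤K = ≤-trans 2≤a a≤K

    instance
      den-nonZero : NonZero den
      den-nonZero = >-nonZero 0<den

    h : Fin n → Fin n → ℚ
    h p q = + (a * weight p q) / den

    h-sym : ∀ p q → h p q ≡ h q p
    h-sym p q = cong (λ w → + (a * w) / den) (weight-sym p q)

    h-bounds : ∀ p q → (0ℚ ℚ.≤ h p q) × (h p q ℚ.≤ 1ℚ)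
    h-bounds p q = subst (ℚ._≤ h p q) (0/n≡0 den) (/-mono-≤ 0 (a * weight p q) den den z≤n)
                 , /-mono-≤ (a * weight p q) 1 den 1 (begin
      a * weight p q * 1        ≡⟨ *-identityʳ (a * weight p q) ⟩
      a * weight p q            ≤⟨ *-monoʳ-≤ a (weight≤ p q) ⟩
      a * (pairs + pred K * D)  ≤⟨ scaled-weight≤ a≤K a+D≤N-1 ⟩
      den                       ≡⟨ *-identityˡ den ⟨
      1 * den                   ∎)
      where open ≤-Reasoning

    degreeSum≡a : ∀ {p} → isAlive G p ≡ true → degreeSum G h p ≡ + (a * den) / den
    degreeSum≡a {p} ap = begin
      degreeSum G h p                                     ≡⟨ sumFin-if-/ (edgeB G p) (λ q → a * weight p q) den ⟩
      + sum (λ q → a * weight p q * [ edgeB G p q ]) / den ≡⟨ cong (λ x → + x / den) (∑-*-assoc a (weight p) (λ q → [ edgeB G p q ])) ⟩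
      + (a * sum (λ q → weight p q * [ edgeB G p q ])) / den ≡⟨ cong (λ x → + (a * x) / den) (weighted-degree ap D≤pairs) ⟩
      + (a * den) / den                                   ∎
      where open ≡-Reasoning

    h-degree : ∀ p → T (isAlive G p) → (ℕtoℚ a ℚ.≤ degreeSum G h p) × (degreeSum G h p ℚ.≤ ℕtoℚ b)
    h-degree p ap =
        subst (ℕtoℚ a ℚ.≤_) (sym degree≡a) (/-mono-≤ a (a * den) 1 den (≤-reflexive (sym (*-identityʳ (a * den)))))
      , subst (ℚ._≤ ℕtoℚ b) (sym degree≡a) (/-mono-≤ (a * den) b den 1 (≤-trans (≤-reflexive (*-identityʳ (a * den))) (*-monoˡ-≤ den a≤b)))
      where
      degree≡a : degreeSum G h p ≡ + (a * den) / den
      degree≡a = degreeSum≡a (Equivalence.to T-≡ ap)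

-- Deleting vertices and edges from a complete graph

memPair-count : ∀ {n} (H : List (Fin n × Fin n)) → sum (λ p → sum (λ q → [ memPair H p q ])) ≤ length H
memPair-count {n} [] = ≤-reflexive (trans (sum-cong-≗ {n} {λ _ → sum {n} (λ _ → 0)} (λ _ → sum-replicate-zero n)) (sum-replicate-zero n))
memPair-count {n} ((u , v) ∷ H) = begin
  sum (λ p → sum (λ q → [ δ p q ∨ memPair H p q ]))
    ≤⟨ sum-mono-≤ (λ p → sum-mono-≤ (λ q → [∨]≤ (δ p q) (memPair H p q))) ⟩
  sum (λ p → sum (λ q → [ δ p q ] + [ memPair H p q ]))
    ≡⟨ ∑∑-distrib-+ (λ p q → [ δ p q ]) (λ p q → [ memPair H p q ]) ⟩
  sum (λ p → sum (λ q → [ δ p q ])) + sum (λ p → sum (λ q → [ memPair H p q ]))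
    ≤⟨ +-mono-≤ (≤-reflexive count-pair) (memPair-count H) ⟩
  suc (length H) ∎
  where
  open ≤-Reasoning
  δ : Fin n → Fin n → Bool
  δ p q = ⌊ u ≟ p ⌋ ∧ ⌊ v ≟ q ⌋
  count-row : ∀ p → sum (λ q → [ δ p q ]) ≡ [ ⌊ u ≟ p ⌋ ]
  count-row p = trans (sum-cong-≗ (λ q → [∧] ⌊ u ≟ p ⌋ ⌊ v ≟ q ⌋))
    (trans (sym (*-distribˡ-sum [ ⌊ u ≟ p ⌋ ] (λ q → [ ⌊ v ≟ q ⌋ ])))
      (trans (cong ([ ⌊ u ≟ p ⌋ ] *_) (count-δ v)) (*-identityʳ _)))
  count-pair : sum (λ p → sum (λ q → [ δ p q ])) ≡ 1
  count-pair = trans (sum-cong-≗ count-row) (count-δ u)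

deleteV-alive-count : ∀ {n} (U : Subset n) → sum (λ p → [ isAlive (deleteV (complete n) U) p ]) + ∣ U ∣ ≡ n
deleteV-alive-count []            = refl
deleteV-alive-count (true  ∷ U) = trans (+-suc _ ∣ U ∣) (cong suc (deleteV-alive-count U))
deleteV-alive-count (false ∷ U) = cong suc (deleteV-alive-count U)

module DeletedComplete {n : ℕ} (U : Subset n) (H : List (Fin n × Fin n)) where

  G : Graph n
  G = deleteE (deleteV (complete n) U) H

  adj-irrefl : ∀ p → adj G p p ≡ false
  adj-irrefl p = cong (λ e → not e ∧ not (memPair H p p) ∧ not (memPair H p p)) (≟-refl p)

  open NearlyComplete G adj-irrefl public

  N+∣U∣≡n : N + ∣ U ∣ ≡ n
  N+∣U∣≡n = deleteV-alive-count U

  missing≤memPair : ∀ p q → [ missing p q ] ≤ [ memPair H p q ] + [ memPair H q p ]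
  missing≤memPair p q = bound (isAlive G p) (isAlive G q) ⌊ p ≟ q ⌋ (memPair H p q) (memPair H q p) (≟-sym q p)
    where
    bound : ∀ a b e x y {e'} → e' ≡ e →
      [ a ∧ (b ∧ not e) ∧ not ((not e ∧ not x ∧ not y) ∧ (not e' ∧ not y ∧ not x)) ] ≤ [ x ] + [ y ]
    bound false _     _     _     _     _    = z≤n
    bound true  false _     _     _     _    = z≤n
    bound true  true  true  _     _     _    = z≤n
    bound true  true  false true  _     _    = s≤s z≤n
    bound true  true  false false true  refl = s≤s z≤n
    bound true  true  false false false refl = z≤n

  D≤2∣H∣ : D ≤ 2 * length H
  D≤2∣H∣ = begin
    D
      ≤⟨ sum-mono-≤ (λ p → sum-mono-≤ (missing≤memPair p)) ⟩
    sum (λ p → sum (λ q → [ memPair H p q ] + [ memPair H q p ]))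
      ≡⟨ ∑∑-distrib-+ (λ p q → [ memPair H p q ]) (λ p q → [ memPair H q p ]) ⟩
    M + sum (λ p → sum (λ q → [ memPair H q p ]))
      ≡⟨ cong (_+_ M) (∑-comm (λ p q → [ memPair H q p ])) ⟩
    M + M
      ≤⟨ +-mono-≤ (memPair-count H) (memPair-count H) ⟩
    length H + length H
      ≡⟨ cong (_+_ (length H)) (+-identityʳ (length H)) ⟨
    2 * length H ∎
    where
    open ≤-Reasoning
    M = sum (λ p → sum (λ q → [ memPair H p q ]))

-- The bound on n

fractionalFactor-conditions : ∀ n b n' a m Δ {N K D} → 2 ≤ a → a ≤ b ∸ Δ →
  (Δ + a) * n' + (b + a ∸ 2 + 2 * m) * (b + a) < (Δ + a) * n →
  N + n' ≡ n → N ≤ K + D → D ≤ 2 * m →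
  a ≤ b × a ≤ K × D ≤ K * pred K × a + D ≤ pred N
fractionalFactor-conditions n b n' a m Δ {N} {K} {D} 2≤a a≤b∸Δ hyp N+n'≡n N≤K+D D≤M =
  a≤b , a≤K , D≤pairs , <⇒≤pred (≤-<-trans (+-mono-≤ a≤Z D≤M) Y<N)
  where
  -- Everything follows from Y (b + a) < b N: the hypothesis with (Δ + a) n' cancelled and Δ + a ≤ b.
  Z M Y : ℕ
  Z = b + a ∸ 2
  M = 2 * m
  Y = Z + M

  Δ+a≤b : Δ + a ≤ b
  Δ+a≤b = subst (_≤ b) (+-comm a Δ) (m≤o∸n⇒m+n≤o a (<⇒≤ Δ<b) a≤b∸Δ)
    where
    Δ<b : Δ < b
    Δ<b = m∸n≢0⇒n<m λ b∸Δ≡0 → contradiction (≤-trans 2≤a (≤-trans a≤b∸Δ (≤-reflexive b∸Δ≡0))) λ ()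

  a≤b : a ≤ b
  a≤b = m+n≤o⇒n≤o Δ Δ+a≤b

  a≤Z : a ≤ Z
  a≤Z = m+n≤o⇒m≤o∸n a (subst (_≤ b + a) (+-comm 2 a) (+-monoˡ-≤ a (≤-trans 2≤a a≤b)))

  b≤Z : b ≤ Z
  b≤Z = m+n≤o⇒m≤o∸n b (+-monoʳ-≤ b 2≤a)

  Y[b+a]<bN : Y * (b + a) < b * N
  Y[b+a]<bN = <-≤-trans (+-cancelˡ-< ((Δ + a) * n') _ _ (subst ((Δ + a) * n' + Y * (b + a) <_) split hyp))
                        (*-monoˡ-≤ N Δ+a≤b)
    where
    split : (Δ + a) * n ≡ (Δ + a) * n' + (Δ + a) * N
    split = trans (cong ((Δ + a) *_) (trans (sym N+n'≡n) (+-comm N n'))) (*-distribˡ-+ (Δ + a) n' N)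

  Y<N : Y < N
  Y<N = *-cancelˡ-< b Y N (≤-<-trans (≤-trans (≤-reflexive (*-comm b Y)) (*-monoʳ-≤ Y (m≤m+n b a))) Y[b+a]<bN)

  Z[b+a]+Ma<bK : Z * (b + a) + M * a < b * K
  Z[b+a]+Ma<bK = +-cancelʳ-< (M * b) _ _ (begin-strict
    Z * (b + a) + M * a + M * b ≡⟨ regroup Z M b a ⟩
    Y * (b + a)                 <⟨ Y[b+a]<bN ⟩
    b * N                       ≤⟨ *-monoʳ-≤ b (≤-trans N≤K+D (+-monoʳ-≤ K D≤M)) ⟩
    b * (K + M)                 ≡⟨ spread b K M ⟩
    b * K + M * b               ∎)
    where
    open ≤-Reasoning
    regroup : ∀ Z M b a → Z * (b + a) + M * a + M * b ≡ (Z + M) * (b + a)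
    regroup = solve-∀
    spread : ∀ b K M → b * (K + M) ≡ b * K + M * b
    spread = solve-∀

  Z<K : Z < K
  Z<K = *-cancelˡ-< b Z K (≤-<-trans (≤-trans (≤-reflexive (*-comm b Z)) (≤-trans (*-monoʳ-≤ Z (m≤m+n b a)) (m≤m+n _ _)))
                                     Z[b+a]+Ma<bK)

  a≤K : a ≤ K
  a≤K = ≤-trans a≤Z (<⇒≤ Z<K)

  D≤pairs : D ≤ K * pred K
  D≤pairs = begin
    D                      ≤⟨ D≤M ⟩
    M                      ≡⟨ *-identityʳ M ⟨
    M * 1                  ≤⟨ *-monoʳ-≤ M (≤-trans (s≤s z≤n) 2≤a) ⟩
    M * a                  ≤⟨ m≤n+m (M * a) (Z * (b + a)) ⟩
    Z * (b + a) + M * a    ≤⟨ <⇒≤ Z[b+a]+Ma<bK ⟩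
    b * K                  ≤⟨ *-monoˡ-≤ K (≤-trans b≤Z (<⇒≤pred Z<K)) ⟩
    pred K * K             ≡⟨ *-comm (pred K) K ⟩
    K * pred K             ∎
    where open ≤-Reasoning

lemma3 : (n b n' a m Δ : ℕ) → 2 ≤ a → a ≤ b ∸ Δ →
    (Δ + a) * n' + (b + a ∸ 2 + 2 * m) * (b + a) < (Δ + a) * n →
    FractionalCriticalDeleted a b n' m (complete n)
lemma3 n b n' a m Δ 2≤a a≤b∸Δ hyp U ∣U∣≡n' H (_ , _ , ∣H∣≡m) =
  let a≤b , a≤K , D≤pairs , a+D≤N-1 = fractionalFactor-conditions n b n' a m Δ 2≤a a≤b∸Δ hyp N+n'≡n N≤K+D D≤2m
  in  fractionalFactor 2≤a a≤b a≤K D≤pairs a+D≤N-1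
  where
  open DeletedComplete U H
  N+n'≡n : N + n' ≡ n
  N+n'≡n = trans (cong (_+_ N) (sym ∣U∣≡n')) N+∣U∣≡n
  D≤2m : D ≤ 2 * m
  D≤2m = subst (λ k → D ≤ 2 * k) ∣H∣≡m D≤2∣H∣
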